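{- Let $\Sigma^{\mathcal I}$ be an indefinitely large signature and $\ll$ an indefinitely large $\ll$-relation on $\mathcal I$. Then for every formula $\Phi(x_0,\dots,x_{n-1})$ the set $\{C\in\mathcal I^n: C\vdash\Phi\}$ of its state declarations belongs to $\mathfrak D_n$. In particular every formula is approximable.
   Context: $\mathcal I$ is a non-empty set with a directed preorder $\le$; $\uparrow i=\{i'\ge i\}$. Contexts: tuples $C=(i_0,\dots,i_{n-1})\in\mathcal I^n$; $()$ empty, $Ci$ extension by $i$. Sets $\mathfrak D_n\subseteq\mathcal P(\mathcal I^n)$: $\mathcal H\in\mathfrak D_0$ iff $\mathcal H=\{()\}$; $\mathcal H\in\mathfrak D_1$ iff $\uparrow i\subseteq\mathcal H$ for some $i$; for $\mathcal H\subseteq\mathcal I^{n+1}$, $\mathcal H\in\mathfrak D_{n+1}$ iff $\{C\in\mathcal I^n:\{i:Ci\in\mathcal H\}\in\mathfrak D_1\}\in\mathfrak D_n$. Signature: $\Sigma$ is a first-order signature with relation symbols only; $\Sigma^{\mathcal I}$ is a set of assignments $R:C$ with $C\in\mathcal I^{\mathrm{arity}(R)}$, at least one per symbol; it is indefinitely large iff $\{C:R:C\in\Sigma^{\mathcal I}\}\in\mathfrak D_n$ for each $n$-ary $R$. A $\ll$-relation is a family $\ll=(\ll_n)_{n\in\mathbb N}$, $\ll_n\subseteq\mathcal I^n$, such that $Ci\in\ll_{n+1}$ implies $C\in\ll_n$; elements of $\ll_n$ are $\ll$-contexts; write $C\ll i$ for $Ci\in\ll_{n+1}$. It is indefinitely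 large iff $\ll_n\in\mathfrak D_n$ for all $n$. Language: first-order formulas over $\Sigma$ with variables $x_0,x_1,\dots$, constant $\bot$, connectives $\to,\land,\lor$, quantifiers $\forall,\exists$, no function symbols; a formula $\Phi(x_0,\dots,x_{n-1})$ is $n$-ary (free variables among $x_0,\dots,x_{n-1}$) and a quantifier applied to an $(n+1)$-ary formula binds $x_n$. State declarations $C\vdash\Phi$ (for $\ll$-contexts $C$ of length $n$ and $n$-ary $\Phi$), defined recursively: $C\vdash\bot$ always; $C\vdash Rx_{k_0}\dots x_{k_{m-1}}$ iff there are $j_0,\dots,j_{m-1}$ with $j_l\ge i_{k_l}$ for all $l$ and $R:(j_0,\dots,j_{m-1})\in\Sigma^{\mathcal I}$; $C\vdash\Phi\circ\Psi$ ($\circ\in\{\to,\land,\lor\}$) iff $C\vdash\Phi$ and $C\vdash\Psi$; $C\vdash\forall x\Psi$ iff $C\vdash\exists x\Psi$ iff $Ci\vdash\Psi$ for some $i$ with $C\ll i$. A formula is approximable if $C\vdash\Phi$ for some $C$. -}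

module Defs where

open import Level using (Level; _⊔_) renaming (suc to lsuc)
open import Data.Nat using (ℕ; zero; suc)
open import Data.Fin using (Fin)
open import Data.Vec using (Vec; []; _∷ʳ_; lookup)
open import Data.Product using (Σ; _×_; _,_)
open import Data.Unit.Polymorphic using (⊤)

record DirPreorder (ℓ : Level) : Set (lsuc ℓ) where
  field
    Carrier   : Set ℓ
    _≤_       : Carrier → Carrier → Set ℓ
    ≤-refl    : ∀ {i} → i ≤ i
    ≤-trans   : ∀ {i j k} → i ≤ j → j ≤ k → i ≤ k
    inhabitant : Carrier
    directed  : ∀ i j → Σ Carrier (λ k → (i ≤ k) × (j ≤ k))

module _ {ℓ : Level} (P : DirPreorder ℓ) where
  open DirPreorder P

  -- Contexts of length n are vectors; Ci is C ∷ʳ i.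
  Ctx : ℕ → Set ℓ
  Ctx n = Vec Carrier n

  Large : (Carrier → Set ℓ) → Set ℓ
  Large H = Σ Carrier (λ i → ∀ j → i ≤ j → H j)

  𝔇 : (n : ℕ) → (Ctx n → Set ℓ) → Set ℓ
  𝔇 zero    H = H []
  𝔇 (suc n) H = 𝔇 n (λ C → Large (λ i → H (C ∷ʳ i)))

record Signature (ℓ : Level) : Set (lsuc ℓ) where
  field
    Symbol : Set ℓ
    arity  : Symbol → ℕ

module _ {ℓ : Level} (S : Signature ℓ) where
  open Signature S

  -- n-ary formulas: free variables among x₀,…,x_{n-1}; quantifiers bind xₙ.
  data Formula : ℕ → Set ℓ where
    ⊥′    : ∀ {n} → Formula n
    rel   : ∀ {n} (R : Symbol) → Vec (Fin n) (arity R) → Formula n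
    _⇒_   : ∀ {n} → Formula n → Formula n → Formula n
    _∧′_  : ∀ {n} → Formula n → Formula n → Formula n
    _∨′_  : ∀ {n} → Formula n → Formula n → Formula n
    ∀′    : ∀ {n} → Formula (suc n) → Formula n
    ∃′    : ∀ {n} → Formula (suc n) → Formula n

module _ {ℓ : Level} (P : DirPreorder ℓ) (S : Signature ℓ) where
  open DirPreorder P
  open Signature S

  SigAssignment : Set (lsuc ℓ)
  SigAssignment = (R : Symbol) → Ctx P (arity R) → Set ℓ

  IsSigAssignment : SigAssignment → Set ℓ
  IsSigAssignment A = ∀ R → Σ (Ctx P (arity R)) (λ C → A R C)

  IndefLargeSig : SigAssignment → Set ℓ
  IndefLargeSig A = ∀ R → 𝔇 P (arity R) (A R)

module _ {ℓ : Level} (P : DirPreorder ℓ) where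
  open DirPreorder P

  record LLRel : Set (lsuc ℓ) where
    field
      ll     : (n : ℕ) → Ctx P n → Set ℓ
      closed : ∀ n (C : Ctx P n) i → ll (suc n) (C ∷ʳ i) → ll n C

  IndefLargeLL : LLRel → Set ℓ
  IndefLargeLL L = ∀ n → 𝔇 P n (LLRel.ll L n)

module _ {ℓ : Level} (P : DirPreorder ℓ) (S : Signature ℓ)
         (A : SigAssignment P S) (L : LLRel P) where
  open DirPreorder P
  open Signature S
  open LLRel L

  -- State declarations C ⊢ Φ (meaningful for ≪-contexts C)
  _⊢_ : ∀ {n} → Ctx P n → Formula S n → Set ℓ
  C ⊢ ⊥′ = ⊤
  C ⊢ rel R ks = Σ (Ctx P (arity R))
                   (λ js → (∀ (l : Fin (arity R)) → lookup C (lookup ks l) ≤ lookup js l) × A R js)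
  C ⊢ (Φ ⇒ Ψ) = (C ⊢ Φ) × (C ⊢ Ψ)
  C ⊢ (Φ ∧′ Ψ) = (C ⊢ Φ) × (C ⊢ Ψ)
  C ⊢ (Φ ∨′ Ψ) = (C ⊢ Φ) × (C ⊢ Ψ)
  _⊢_ {n} C (∀′ Ψ) = Σ Carrier (λ i → ll (suc n) (C ∷ʳ i) × ((C ∷ʳ i) ⊢ Ψ))
  _⊢_ {n} C (∃′ Ψ) = Σ Carrier (λ i → ll (suc n) (C ∷ʳ i) × ((C ∷ʳ i) ⊢ Ψ))

  Declarations : ∀ {n} → Formula S n → Ctx P n → Set ℓ
  Declarations {n} Φ C = ll n C × (C ⊢ Φ)

  Approximable : ∀ {n} → Formula S n → Set ℓ
  Approximable {n} Φ = Σ (Ctx P n) (Declarations Φ)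

module Submission where

-- Each 𝔇ₙ behaves like a filter on 𝓘ⁿ: it is upward closed, closed under
-- binary intersections (by directedness), and contains no empty set. Atoms are
-- declared in every context, because Σ^𝓘(R) ∈ 𝔇 contains tuples lying above
-- any given bound of the context; connectives are handled by intersection.
-- A quantified formula over Ψ is declared at C once Ψ is declared at some
-- ≪-context Ci: the recursive clause of 𝔇ₙ₊₁ supplies such an i, and C is a
-- ≪-context because ≪ is closed under prefixes.

open import Defs
open import Level using (Level)
open import Data.Nat using (ℕ; zero; suc)
open import Data.Vec using (Vec; []; _∷_; _∷ʳ_; lookup)
open import Data.Vec.Relation.Unary.All as All using (All; []; _∷_)
open import Data.Vec.Relation.Unary.All.Properties using (lookup⁺)
open import Data.Product using (_×_; Σ; _,_)
open import Data.Unit.Polymorphic using (tt)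

All-∷ʳ : ∀ {a p} {A : Set a} {P : A → Set p} {n} {xs : Vec A n} {x : A} →
         All P xs → P x → All P (xs ∷ʳ x)
All-∷ʳ []         px = px ∷ []
All-∷ʳ (py ∷ pxs) px = py ∷ All-∷ʳ pxs px

module _ {ℓ : Level} (P : DirPreorder ℓ) where
  open DirPreorder P

  upperBound : ∀ {n} (C : Ctx P n) → Σ Carrier (λ b → All (_≤ b) C)
  upperBound []      = inhabitant , []
  upperBound (x ∷ C) with upperBound C
  ... | b , C≤b with directed x b
  ...   | k , x≤k , b≤k = k , x≤k ∷ All.map (λ c≤b → ≤-trans c≤b b≤k) C≤b

  Large-mono : ∀ {H H′ : Carrier → Set ℓ} → (∀ i → H i → H′ i) → Large P H → Large P H′
  Large-mono H⊆H′ (i , ↑i⊆H) = i , λ j i≤j → H⊆H′ j (↑i⊆H j i≤j)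

  Large-∩ : ∀ {H H′ : Carrier → Set ℓ} → Large P H → Large P H′ → Large P (λ i → H i × H′ i)
  Large-∩ (i , ↑i⊆H) (i′ , ↑i′⊆H′) with directed i i′
  ... | k , i≤k , i′≤k = k , λ j k≤j → ↑i⊆H j (≤-trans i≤k k≤j) , ↑i′⊆H′ j (≤-trans i′≤k k≤j)

  Large-nonempty : ∀ {H : Carrier → Set ℓ} → Large P H → Σ Carrier H
  Large-nonempty (i , ↑i⊆H) = i , ↑i⊆H i ≤-refl

  𝔇-mono : ∀ n {H H′ : Ctx P n → Set ℓ} → (∀ C → H C → H′ C) → 𝔇 P n H → 𝔇 P n H′
  𝔇-mono zero    H⊆H′ h = H⊆H′ [] h
  𝔇-mono (suc n) H⊆H′   = 𝔇-mono n (λ C → Large-mono (λ i → H⊆H′ (C ∷ʳ i)))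

  𝔇-∩ : ∀ n {H H′ : Ctx P n → Set ℓ} → 𝔇 P n H → 𝔇 P n H′ → 𝔇 P n (λ C → H C × H′ C)
  𝔇-∩ zero    h h′ = h , h′
  𝔇-∩ (suc n) h h′ = 𝔇-mono n (λ C (l , l′) → Large-∩ l l′) (𝔇-∩ n h h′)

  𝔇-nonempty : ∀ n {H : Ctx P n → Set ℓ} → 𝔇 P n H → Σ (Ctx P n) H
  𝔇-nonempty zero    h = [] , h
  𝔇-nonempty (suc n) h with 𝔇-nonempty n h
  ... | C , l with Large-nonempty l
  ...   | i , Ci∈H = C ∷ʳ i , Ci∈H

  𝔇-boundedBelow : ∀ n b → 𝔇 P n (All (b ≤_))
  𝔇-boundedBelow zero    b = []
  𝔇-boundedBelow (suc n) b =
    𝔇-mono n (λ C b≤C → b , λ j b≤j → All-∷ʳ b≤C b≤j) (𝔇-boundedBelow n b)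

  𝔇-element-above : ∀ n {H : Ctx P n → Set ℓ} → 𝔇 P n H → ∀ b →
                    Σ (Ctx P n) (λ C → H C × All (b ≤_) C)
  𝔇-element-above n h b = 𝔇-nonempty n (𝔇-∩ n h (𝔇-boundedBelow n b))

module _ {ℓ : Level} (P : DirPreorder ℓ) (S : Signature ℓ)
         (A : SigAssignment P S) (L : LLRel P)
         (A-large : IndefLargeSig P S A) (≪-large : IndefLargeLL P L) where
  open DirPreorder P
  open Signature S
  open LLRel L

  rel-declared : ∀ {n} (C : Ctx P n) R ks → _⊢_ P S A L C (rel R ks)
  rel-declared C R ks with upperBound P C
  ... | b , C≤b with 𝔇-element-above P (arity R) (A-large R) b
  ...   | js , R:js , b≤js =
    js , (λ l → ≤-trans (lookup⁺ C≤b (lookup ks l)) (lookup⁺ b≤js l)) , R:js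

  declarations-of-valid : ∀ {n} (Φ : Formula S n) → (∀ C → _⊢_ P S A L C Φ) →
                          𝔇 P n (Declarations P S A L Φ)
  declarations-of-valid {n} Φ valid = 𝔇-mono P n (λ C C∈≪ → C∈≪ , valid C) (≪-large n)

  declarations-× : ∀ {n} (Φ Ψ : Formula S n) →
                   𝔇 P n (Declarations P S A L Φ) → 𝔇 P n (Declarations P S A L Ψ) →
                   𝔇 P n (λ C → ll n C × _⊢_ P S A L C Φ × _⊢_ P S A L C Ψ)
  declarations-× {n} Φ Ψ dΦ dΨ =
    𝔇-mono P n (λ C ((C∈≪ , C⊢Φ) , (_ , C⊢Ψ)) → C∈≪ , C⊢Φ , C⊢Ψ) (𝔇-∩ P n dΦ dΨ)

  declarations-quantifier : ∀ {n} (Ψ : Formula S (suc n)) →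
    𝔇 P (suc n) (Declarations P S A L Ψ) →
    𝔇 P n (λ C → ll n C × Σ Carrier (λ i → ll (suc n) (C ∷ʳ i) × _⊢_ P S A L (C ∷ʳ i) Ψ))
  declarations-quantifier {n} Ψ dΨ = 𝔇-mono P n witness dΨ
    where
    witness : ∀ C → Large P (λ i → Declarations P S A L Ψ (C ∷ʳ i)) →
              ll n C × Σ Carrier (λ i → ll (suc n) (C ∷ʳ i) × _⊢_ P S A L (C ∷ʳ i) Ψ)
    witness C l with Large-nonempty P l
    ... | i , Ci∈≪ , Ci⊢Ψ = closed n C i Ci∈≪ , i , Ci∈≪ , Ci⊢Ψ

  declarations-large : ∀ n (Φ : Formula S n) → 𝔇 P n (Declarations P S A L Φ)
  declarations-large n ⊥′         = declarations-of-valid {n} ⊥′ (λ _ → tt)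
  declarations-large n (rel R ks) = declarations-of-valid (rel R ks) (λ C → rel-declared C R ks)
  declarations-large n (Φ ⇒ Ψ)    = declarations-× Φ Ψ (declarations-large n Φ) (declarations-large n Ψ)
  declarations-large n (Φ ∧′ Ψ)   = declarations-× Φ Ψ (declarations-large n Φ) (declarations-large n Ψ)
  declarations-large n (Φ ∨′ Ψ)   = declarations-× Φ Ψ (declarations-large n Φ) (declarations-large n Ψ)
  declarations-large n (∀′ Ψ)     = declarations-quantifier Ψ (declarations-large (suc n) Ψ)
  declarations-large n (∃′ Ψ)     = declarations-quantifier Ψ (declarations-large (suc n) Ψ)

lemma3p3 : {ℓ : Level} (P : DirPreorder ℓ) (S : Signature ℓ)
           (A : SigAssignment P S) (L : LLRel P) →
           IsSigAssignment P S A → IndefLargeSig P S A → IndefLargeLL P L →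
           (n : ℕ) (Φ : Formula S n) →
           𝔇 P n (Declarations P S A L Φ) × Approximable P S A L Φ
lemma3p3 P S A L _ A-large ≪-large n Φ = d , 𝔇-nonempty P n d
  where
  d : 𝔇 P n (Declarations P S A L Φ)
  d = declarations-large P S A L A-large ≪-large n Φ
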